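{- Let $\alpha,\beta\in\{\mathbf{0},\mathbf{1}\}^*$ and suppose $\alpha$ is a substring of $\beta$. Then $B\vdash\overline{\alpha}\sqsubseteq\overline{\beta}$.
   Context: Bit strings are elements of $\{\mathbf{0},\mathbf{1}\}^*$; $\varepsilon$ is the empty string; $\alpha$ is a substring of $\beta$ if $\gamma\alpha\delta=\beta$ for some bit strings $\gamma,\delta$. The language $\mathcal{L}_{BT}$ has constant symbols $e,0,1$, binary function symbol $\circ$ (also written as juxtaposition), and binary relation symbol $\sqsubseteq$. Biterals: $\overline{\varepsilon}=e$, $\overline{\alpha\mathbf{0}}=\overline{\alpha}\circ 0$, $\overline{\alpha\mathbf{1}}=\overline{\alpha}\circ 1$. The theory $B$ has the axioms: (1) $\forall x[x=ex\wedge x=xe]$; (2) $\forall xyz[(xy)z=x(yz)]$; (3) $\forall xy[x\neq y\to(x0\neq y0\wedge x1\neq y1)]$; (4) $\forall xy[x0\neq y1]$; (5) $\forall x[x\sqsubseteq e\leftrightarrow x=e]$; (6) $\forall x[x\sqsubseteq 0\leftrightarrow(x=e\vee x=0)]$; (7) $\forall x[x\sqsubseteq 1\leftrightarrow(x=e\vee x=1)]$; (8)–(11): for each $a,b\in\{0,1\}$, $\forall xy[x\sqsubseteq ayb\leftrightarrow(x=ayb\vee x\sqsubseteq ay\vee x\sqsubseteq yb)]$. -}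

module Defs where

open import Data.Nat using (ℕ; zero; suc)
open import Data.Fin using (Fin; zero; suc)
open import Data.Bool using (Bool; true; false)
open import Data.List using (List; []; _∷_; _++_; foldl; map)
open import Data.List.Membership.Propositional using (_∈_)
open import Data.List.Relation.Unary.All using (All)
open import Data.Product using (Σ; _×_; ∃₂)
open import Relation.Binary.PropositionalEquality using (_≡_)

-- Bit strings: elements of {0,1}^*, with false = 0 and true = 1.

BitString : Set
BitString = List Bool

IsSubstring : BitString → BitString → Set
IsSubstring α β = ∃₂ λ (γ δ : BitString) → γ ++ α ++ δ ≡ β

infixl 8 _·_
data Term (n : ℕ) : Set where
  var : Fin n → Term n
  e   : Term n
  𝟘   : Term n
  𝟙   : Term n
  _·_ : Term n → Term n → Term n

infix 6 _≐_ _⊑_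
infixr 5 _∧'_
infixr 4 _∨'_
infixr 3 _⇒_
data Formula (n : ℕ) : Set where
  ⊥'   : Formula n
  _≐_  : Term n → Term n → Formula n
  _⊑_  : Term n → Term n → Formula n
  _⇒_  : Formula n → Formula n → Formula n
  _∧'_ : Formula n → Formula n → Formula n
  _∨'_ : Formula n → Formula n → Formula n
  ∀'   : Formula (suc n) → Formula n
  ∃'   : Formula (suc n) → Formula n

¬' : ∀ {n} → Formula n → Formula n
¬' φ = φ ⇒ ⊥'

infixr 3 _⇔_
_⇔_ : ∀ {n} → Formula n → Formula n → Formula n
φ ⇔ ψ = (φ ⇒ ψ) ∧' (ψ ⇒ φ)

infix 6 _≠_
_≠_ : ∀ {n} → Term n → Term n → Formula n
s ≠ t = ¬' (s ≐ t)

renT : ∀ {n m} → (Fin n → Fin m) → Term n → Term m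
renT ρ (var i) = var (ρ i)
renT ρ e = e
renT ρ 𝟘 = 𝟘
renT ρ 𝟙 = 𝟙
renT ρ (s · t) = renT ρ s · renT ρ t

liftR : ∀ {n m} → (Fin n → Fin m) → Fin (suc n) → Fin (suc m)
liftR ρ zero = zero
liftR ρ (suc i) = suc (ρ i)

renF : ∀ {n m} → (Fin n → Fin m) → Formula n → Formula m
renF ρ ⊥' = ⊥'
renF ρ (s ≐ t) = renT ρ s ≐ renT ρ t
renF ρ (s ⊑ t) = renT ρ s ⊑ renT ρ t
renF ρ (φ ⇒ ψ) = renF ρ φ ⇒ renF ρ ψ
renF ρ (φ ∧' ψ) = renF ρ φ ∧' renF ρ ψ
renF ρ (φ ∨' ψ) = renF ρ φ ∨' renF ρ ψ
renF ρ (∀' φ) = ∀' (renF (liftR ρ) φ)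
renF ρ (∃' φ) = ∃' (renF (liftR ρ) φ)

subT : ∀ {n m} → (Fin n → Term m) → Term n → Term m
subT σ (var i) = σ i
subT σ e = e
subT σ 𝟘 = 𝟘
subT σ 𝟙 = 𝟙
subT σ (s · t) = subT σ s · subT σ t

liftS : ∀ {n m} → (Fin n → Term m) → Fin (suc n) → Term (suc m)
liftS σ zero = var zero
liftS σ (suc i) = renT suc (σ i)

subF : ∀ {n m} → (Fin n → Term m) → Formula n → Formula m
subF σ ⊥' = ⊥'
subF σ (s ≐ t) = subT σ s ≐ subT σ t
subF σ (s ⊑ t) = subT σ s ⊑ subT σ t
subF σ (φ ⇒ ψ) = subF σ φ ⇒ subF σ ψ
subF σ (φ ∧' ψ) = subF σ φ ∧' subF σ ψ
subF σ (φ ∨' ψ) = subF σ φ ∨' subF σ ψ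
subF σ (∀' φ) = ∀' (subF (liftS σ) φ)
subF σ (∃' φ) = ∃' (subF (liftS σ) φ)

wkF : ∀ {n} → Formula n → Formula (suc n)
wkF = renF suc

single : ∀ {n} → Term n → Fin (suc n) → Term n
single t zero = t
single t (suc i) = var i

_[_] : ∀ {n} → Formula (suc n) → Term n → Formula n
φ [ t ] = subF (single t) φ

infix 2 _⊢_
data _⊢_ {n : ℕ} (Γ : List (Formula n)) : Formula n → Set where
  hyp  : ∀ {φ} → φ ∈ Γ → Γ ⊢ φ
  ⇒I   : ∀ {φ ψ} → (φ ∷ Γ) ⊢ ψ → Γ ⊢ φ ⇒ ψ
  ⇒E   : ∀ {φ ψ} → Γ ⊢ φ ⇒ ψ → Γ ⊢ φ → Γ ⊢ ψ
  ∧I   : ∀ {φ ψ} → Γ ⊢ φ → Γ ⊢ ψ → Γ ⊢ φ ∧' ψ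
  ∧E₁  : ∀ {φ ψ} → Γ ⊢ φ ∧' ψ → Γ ⊢ φ
  ∧E₂  : ∀ {φ ψ} → Γ ⊢ φ ∧' ψ → Γ ⊢ ψ
  ∨I₁  : ∀ {φ ψ} → Γ ⊢ φ → Γ ⊢ φ ∨' ψ
  ∨I₂  : ∀ {φ ψ} → Γ ⊢ ψ → Γ ⊢ φ ∨' ψ
  ∨E   : ∀ {φ ψ χ} → Γ ⊢ φ ∨' ψ → (φ ∷ Γ) ⊢ χ → (ψ ∷ Γ) ⊢ χ → Γ ⊢ χ
  ⊥E   : ∀ {φ} → Γ ⊢ ⊥' → Γ ⊢ φ
  raa  : ∀ {φ} → (¬' φ ∷ Γ) ⊢ ⊥' → Γ ⊢ φ
  ∀I   : ∀ {φ} → map wkF Γ ⊢ φ → Γ ⊢ ∀' φ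
  ∀E   : ∀ {φ} → Γ ⊢ ∀' φ → (t : Term n) → Γ ⊢ φ [ t ]
  ∃I   : ∀ {φ} (t : Term n) → Γ ⊢ φ [ t ] → Γ ⊢ ∃' φ
  ∃E   : ∀ {φ ψ} → Γ ⊢ ∃' φ → (φ ∷ map wkF Γ) ⊢ wkF ψ → Γ ⊢ ψ
  ≐refl  : ∀ {t} → Γ ⊢ t ≐ t
  ≐subst : ∀ {s t} (φ : Formula (suc n)) → Γ ⊢ s ≐ t → Γ ⊢ φ [ s ] → Γ ⊢ φ [ t ]

bitT : ∀ {n} → Bool → Term n
bitT false = 𝟘
bitT true  = 𝟙

private
  x₁ y₁ : Term 2      -- in ∀x∀y, x = var 1, y = var 0
  x₁ = var (suc zero)
  y₁ = var zero

data AxB : Formula 0 → Set where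
  ax1 : AxB (∀' ((var zero ≐ e · var zero) ∧' (var zero ≐ var zero · e)))
  ax2 : AxB (∀' (∀' (∀' ((var (suc (suc zero)) · var (suc zero)) · var zero
                          ≐ var (suc (suc zero)) · (var (suc zero) · var zero)))))
  ax3 : AxB (∀' (∀' ((x₁ ≠ y₁) ⇒ ((x₁ · 𝟘 ≠ y₁ · 𝟘) ∧' (x₁ · 𝟙 ≠ y₁ · 𝟙)))))
  ax4 : AxB (∀' (∀' (x₁ · 𝟘 ≠ y₁ · 𝟙)))
  ax5 : AxB (∀' (var zero ⊑ e ⇔ var zero ≐ e))
  ax6 : AxB (∀' (var zero ⊑ 𝟘 ⇔ (var zero ≐ e ∨' var zero ≐ 𝟘)))
  ax7 : AxB (∀' (var zero ⊑ 𝟙 ⇔ (var zero ≐ e ∨' var zero ≐ 𝟙)))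
  -- axioms (8)–(11), one for each a, b ∈ {0,1}
  ax8-11 : (a b : Bool) →
    AxB (∀' (∀' (x₁ ⊑ (bitT a · y₁) · bitT b ⇔
                   (x₁ ≐ (bitT a · y₁) · bitT b
                    ∨' x₁ ⊑ bitT a · y₁
                    ∨' x₁ ⊑ y₁ · bitT b))))

B⊢_ : Formula 0 → Set
B⊢ φ = Σ (List (Formula 0)) λ Γ → All AxB Γ × (Γ ⊢ φ)

biteral : BitString → Term 0
biteral = foldl (λ t b → t · bitT b) e

module Submission where

-- A biteral of length at least two has the shape (a ∘ μ̄) ∘ b up to associativity and the
-- identity e, so axioms (8)–(11) say that everything below a ∘ μ̄ or below μ̄ ∘ b is below it;
-- axioms (5)–(7) cover the short biterals.  Hence x ⊑ β̄ survives adding a bit at either end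
-- of β, and α ⊑ (γαδ)‾ follows from ᾱ ⊑ ᾱ by adding the bits of δ and then those of γ.

open import Defs
open import Data.Fin using (Fin; zero; suc)
open import Data.Bool using (Bool; true; false)
open import Data.List using (List; []; _∷_; _++_; _∷ʳ_; foldl; map)
open import Data.List.Properties using (foldl-∷ʳ; ++-assoc; ++-identityʳ)
open import Data.List.Reverse using (reverseView; []; _∶_∶ʳ_)
open import Data.List.Relation.Unary.All using (universal)
open import Data.List.Relation.Unary.All.Properties using (map⁺)
open import Data.List.Relation.Unary.Any using (here; there)
open import Data.Product using (Σ; proj₁; proj₂; _,_; -,_)
open import Data.Sum using (_⊎_; inj₁; inj₂)
open import Function using (_∘_)
open import Relation.Binary.PropositionalEquality
  using (_≡_; refl; sym; trans; cong; cong₂; subst)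

subT-renT : ∀ {k m n} (σ : Fin m → Term n) (ρ : Fin k → Fin m) (s : Term k) →
            subT σ (renT ρ s) ≡ subT (σ ∘ ρ) s
subT-renT σ ρ (var i) = refl
subT-renT σ ρ e       = refl
subT-renT σ ρ 𝟘       = refl
subT-renT σ ρ 𝟙       = refl
subT-renT σ ρ (s · t) = cong₂ _·_ (subT-renT σ ρ s) (subT-renT σ ρ t)

subT-subT : ∀ {k m n} (σ : Fin m → Term n) (τ : Fin k → Term m) (s : Term k) →
            subT σ (subT τ s) ≡ subT (subT σ ∘ τ) s
subT-subT σ τ (var i) = refl
subT-subT σ τ e       = refl
subT-subT σ τ 𝟘       = refl
subT-subT σ τ 𝟙       = refl
subT-subT σ τ (s · t) = cong₂ _·_ (subT-subT σ τ s) (subT-subT σ τ t)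

subT-closed : (σ : Fin 0 → Term 0) (s : Term 0) → subT σ s ≡ s
subT-closed σ (var ())
subT-closed σ e       = refl
subT-closed σ 𝟘       = refl
subT-closed σ 𝟙       = refl
subT-closed σ (s · t) = cong₂ _·_ (subT-closed σ s) (subT-closed σ t)

subT-renT-closed : ∀ {m} (σ : Fin m → Term 0) (ρ : Fin 0 → Fin m) (s : Term 0) →
                   subT σ (renT ρ s) ≡ s
subT-renT-closed σ ρ s = trans (subT-renT σ ρ s) (subT-closed (σ ∘ ρ) s)

-- Each rule is ≐subst along a one-hole formula whose remaining terms are weakened closed
-- terms, which the substitution leaves unchanged.
module Equality {Γ : List (Formula 0)} where

  ≐-sym : ∀ {s t} → Γ ⊢ s ≐ t → Γ ⊢ t ≐ s
  ≐-sym {s} {t} s≐t =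
    subst (Γ ⊢_) (cong (t ≐_) (subT-renT-closed (single t) suc s))
      (≐subst (var zero ≐ renT suc s) s≐t
        (subst (Γ ⊢_) (cong (s ≐_) (sym (subT-renT-closed (single s) suc s))) ≐refl))

  ≐-trans : ∀ {s t u} → Γ ⊢ s ≐ t → Γ ⊢ t ≐ u → Γ ⊢ s ≐ u
  ≐-trans {s} {t} {u} s≐t t≐u =
    subst (Γ ⊢_) (cong (_≐ u) (subT-renT-closed (single u) suc s))
      (≐subst (renT suc s ≐ var zero) t≐u
        (subst (Γ ⊢_) (cong (_≐ t) (sym (subT-renT-closed (single t) suc s))) s≐t))

  ⊑-respʳ-≐ : ∀ {s t u} → Γ ⊢ t ≐ u → Γ ⊢ s ⊑ t → Γ ⊢ s ⊑ u
  ⊑-respʳ-≐ {s} {t} {u} t≐u s⊑t =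
    subst (Γ ⊢_) (cong (_⊑ u) (subT-renT-closed (single u) suc s))
      (≐subst (renT suc s ⊑ var zero) t≐u
        (subst (Γ ⊢_) (cong (_⊑ t) (sym (subT-renT-closed (single t) suc s))) s⊑t))

  ·-congʳ : ∀ {t u} c → Γ ⊢ t ≐ u → Γ ⊢ t · c ≐ u · c
  ·-congʳ {t} {u} c t≐u =
    subst (Γ ⊢_) (instance≡ u)
      (≐subst (renT suc t · renT suc c ≐ var zero · renT suc c) t≐u
        (subst (Γ ⊢_) (sym (instance≡ t)) ≐refl))
    where
    instance≡ : ∀ v → (renT suc t · renT suc c ≐ var zero · renT suc c) [ v ] ≡ (t · c ≐ v · c)
    instance≡ v = cong₂ (λ t′ c′ → t′ · c′ ≐ v · c′)
                    (subT-renT-closed (single v) suc t) (subT-renT-closed (single v) suc c)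

open Equality

B-axioms′ : List (Σ (Formula 0) AxB)
B-axioms′ = (-, ax1) ∷ (-, ax2) ∷ (-, ax5) ∷ (-, ax6) ∷ (-, ax7)
          ∷ (-, ax8-11 false false) ∷ (-, ax8-11 false true)
          ∷ (-, ax8-11 true false) ∷ (-, ax8-11 true true) ∷ []

B-axioms : List (Formula 0)
B-axioms = map proj₁ B-axioms′

infix 2 ⊢ᴮ_
⊢ᴮ_ : Formula 0 → Set
⊢ᴮ φ = B-axioms ⊢ φ

⊢ᴮ⇒B⊢ : ∀ {φ} → ⊢ᴮ φ → B⊢ φ
⊢ᴮ⇒B⊢ d = B-axioms , map⁺ (universal proj₂ B-axioms′) , d

⇔-elimˡ : ∀ {n} {Γ : List (Formula n)} {φ ψ} → Γ ⊢ φ ⇔ ψ → Γ ⊢ ψ → Γ ⊢ φ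
⇔-elimˡ φ⇔ψ = ⇒E (∧E₂ φ⇔ψ)

⇔-elimʳ : ∀ {n} {Γ : List (Formula n)} {φ ψ} → Γ ⊢ φ ⇔ ψ → Γ ⊢ φ → Γ ⊢ ψ
⇔-elimʳ φ⇔ψ = ⇒E (∧E₁ φ⇔ψ)

·-identityˡ : ∀ t → ⊢ᴮ e · t ≐ t
·-identityˡ t = ≐-sym (∧E₁ (∀E (hyp (here refl)) t))

·-identityʳ : ∀ t → ⊢ᴮ t · e ≐ t
·-identityʳ t = ≐-sym (∧E₂ (∀E (hyp (here refl)) t))

·-assoc : ∀ x y z → ⊢ᴮ (x · y) · z ≐ x · (y · z)
·-assoc x y z = subst (⊢ᴮ_) instance≡ (∀E (∀E (∀E (hyp (there (here refl))) x) y) z)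
  where
  closed≡ : subT (single z) (subT (liftS (single y)) (renT suc (renT suc x))) ≡ x
  closed≡ = trans (cong (subT (single z))
                     (trans (subT-renT _ suc (renT suc x)) (subT-renT _ suc x)))
                  (trans (subT-subT _ _ x) (subT-closed _ x))
  instance≡ : _ ≡ ((x · y) · z ≐ x · (y · z))
  instance≡ = cong₂ (λ x′ y′ → (x′ · y′) · z ≐ x′ · (y′ · z))
                closed≡ (subT-renT-closed (single z) suc y)

⊑-e-iff : ∀ x → ⊢ᴮ x ⊑ e ⇔ x ≐ e
⊑-e-iff x = ∀E (hyp (there (there (here refl)))) x

⊑-bit-iff : ∀ b x → ⊢ᴮ x ⊑ bitT b ⇔ (x ≐ e ∨' x ≐ bitT b)
⊑-bit-iff false x = ∀E (hyp (there (there (there (here refl))))) x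
⊑-bit-iff true  x = ∀E (hyp (there (there (there (there (here refl)))))) x

⊑-bit·bit-iff : ∀ a b x y →
  ⊢ᴮ x ⊑ (bitT a · y) · bitT b ⇔
     (x ≐ (bitT a · y) · bitT b ∨' x ⊑ bitT a · y ∨' x ⊑ y · bitT b)
⊑-bit·bit-iff a b x y =
  subst (⊢ᴮ_ ∘ axiom-body a b) (subT-renT-closed (single y) suc x) (instantiate a b)
  where
  axiom-body : Bool → Bool → Term 0 → Formula 0
  axiom-body a b x′ = x′ ⊑ (bitT a · y) · bitT b ⇔
                        (x′ ≐ (bitT a · y) · bitT b ∨' x′ ⊑ bitT a · y ∨' x′ ⊑ y · bitT b)
  instantiate : ∀ a b → ⊢ᴮ axiom-body a b (subT (single y) (renT suc x))
  instantiate false false =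
    ∀E (∀E (hyp (there (there (there (there (there (here refl))))))) x) y
  instantiate false true  =
    ∀E (∀E (hyp (there (there (there (there (there (there (here refl)))))))) x) y
  instantiate true  false =
    ∀E (∀E (hyp (there (there (there (there (there (there (there (here refl))))))))) x) y
  instantiate true  true  =
    ∀E (∀E (hyp (there (there (there (there (there (there (there (there (here refl)))))))))) x) y

infixl 8 _·bits_
_·bits_ : ∀ {n} → Term n → BitString → Term n
t ·bits μ = foldl (λ u b → u · bitT b) t μ

·bits-congˡ : ∀ {t u} μ → ⊢ᴮ t ≐ u → ⊢ᴮ t ·bits μ ≐ u ·bits μ
·bits-congˡ []      t≐u = t≐u
·bits-congˡ (b ∷ μ) t≐u = ·bits-congˡ μ (·-congʳ (bitT b) t≐u)

·-·bits-assoc : ∀ t s μ → ⊢ᴮ t · (s ·bits μ) ≐ (t · s) ·bits μ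
·-·bits-assoc t s []      = ≐refl
·-·bits-assoc t s (b ∷ μ) =
  ≐-trans (·-·bits-assoc t (s · bitT b) μ) (·bits-congˡ μ (≐-sym (·-assoc t s (bitT b))))

biteral-∷ : ∀ a μ → ⊢ᴮ bitT a · biteral μ ≐ biteral (a ∷ μ)
biteral-∷ a μ =
  ≐-trans (·-·bits-assoc (bitT a) e μ)
          (·bits-congˡ μ (≐-trans (·-identityʳ (bitT a)) (≐-sym (·-identityˡ (bitT a)))))

biteral-∷ʳ : ∀ μ b → biteral (μ ∷ʳ b) ≡ biteral μ · bitT b
biteral-∷ʳ μ b = foldl-∷ʳ _ e b μ

⊑-e⇒≐e : ∀ {x} → ⊢ᴮ x ⊑ e → ⊢ᴮ x ≐ e
⊑-e⇒≐e {x} = ⇔-elimʳ (⊑-e-iff x)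

e⊑e : ⊢ᴮ e ⊑ e
e⊑e = ⇔-elimˡ (⊑-e-iff e) ≐refl

⊑-biteral-singleton : ∀ {x} b → (⊢ᴮ x ≐ e) ⊎ (⊢ᴮ x ≐ biteral (b ∷ [])) → ⊢ᴮ x ⊑ biteral (b ∷ [])
⊑-biteral-singleton {x} b cases =
  ⊑-respʳ-≐ (≐-sym (·-identityˡ (bitT b))) (⇔-elimˡ (⊑-bit-iff b x) (disjunct cases))
  where
  disjunct : (⊢ᴮ x ≐ e) ⊎ (⊢ᴮ x ≐ biteral (b ∷ [])) → ⊢ᴮ x ≐ e ∨' x ≐ bitT b
  disjunct (inj₁ x≐e)  = ∨I₁ x≐e
  disjunct (inj₂ x≐b̄) = ∨I₂ (≐-trans x≐b̄ (·-identityˡ (bitT b)))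

⊑-biteral-∷∷ʳ : ∀ {x} a μ b →
  (⊢ᴮ x ≐ biteral ((a ∷ μ) ∷ʳ b)) ⊎ (⊢ᴮ x ⊑ biteral (a ∷ μ)) ⊎ (⊢ᴮ x ⊑ biteral (μ ∷ʳ b)) →
  ⊢ᴮ x ⊑ biteral ((a ∷ μ) ∷ʳ b)
⊑-biteral-∷∷ʳ {x} a μ b cases =
  ⊑-respʳ-≐ unfolded≐ (⇔-elimˡ (⊑-bit·bit-iff a b x (biteral μ)) (disjunct cases))
  where
  unfolded≐ : ⊢ᴮ (bitT a · biteral μ) · bitT b ≐ biteral ((a ∷ μ) ∷ʳ b)
  unfolded≐ = subst (λ t → ⊢ᴮ (bitT a · biteral μ) · bitT b ≐ t)
                    (sym (biteral-∷ʳ (a ∷ μ) b)) (·-congʳ (bitT b) (biteral-∷ a μ))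
  disjunct : (⊢ᴮ x ≐ biteral ((a ∷ μ) ∷ʳ b)) ⊎ (⊢ᴮ x ⊑ biteral (a ∷ μ))
               ⊎ (⊢ᴮ x ⊑ biteral (μ ∷ʳ b)) →
             ⊢ᴮ x ≐ (bitT a · biteral μ) · bitT b ∨' x ⊑ bitT a · biteral μ ∨' x ⊑ biteral μ · bitT b
  disjunct (inj₁ x≐β)        = ∨I₁ (≐-trans x≐β (≐-sym unfolded≐))
  disjunct (inj₂ (inj₁ x⊑aμ)) = ∨I₂ (∨I₁ (⊑-respʳ-≐ (≐-sym (biteral-∷ a μ)) x⊑aμ))
  disjunct (inj₂ (inj₂ x⊑μb)) = ∨I₂ (∨I₂ (subst (λ t → ⊢ᴮ x ⊑ t) (biteral-∷ʳ μ b) x⊑μb))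

⊑-refl : ∀ α → ⊢ᴮ biteral α ⊑ biteral α
⊑-refl []      = e⊑e
⊑-refl (a ∷ β) with reverseView β
... | []          = ⊑-biteral-singleton a (inj₂ ≐refl)
... | μ ∶ _ ∶ʳ b  = ⊑-biteral-∷∷ʳ a μ b (inj₁ ≐refl)

⊑-∷ʳ⁺ : ∀ {x} β b → ⊢ᴮ x ⊑ biteral β → ⊢ᴮ x ⊑ biteral (β ∷ʳ b)
⊑-∷ʳ⁺ []      b x⊑β = ⊑-biteral-singleton b (inj₁ (⊑-e⇒≐e x⊑β))
⊑-∷ʳ⁺ (a ∷ μ) b x⊑β = ⊑-biteral-∷∷ʳ a μ b (inj₂ (inj₁ x⊑β))

⊑-∷⁺ : ∀ {x} a β → ⊢ᴮ x ⊑ biteral β → ⊢ᴮ x ⊑ biteral (a ∷ β)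
⊑-∷⁺ a β x⊑β with reverseView β
... | []         = ⊑-biteral-singleton a (inj₁ (⊑-e⇒≐e x⊑β))
... | μ ∶ _ ∶ʳ b = ⊑-biteral-∷∷ʳ a μ b (inj₂ (inj₂ x⊑β))

⊑-++⁺ˡ : ∀ {x} γ β → ⊢ᴮ x ⊑ biteral β → ⊢ᴮ x ⊑ biteral (γ ++ β)
⊑-++⁺ˡ []      β x⊑β = x⊑β
⊑-++⁺ˡ (a ∷ γ) β x⊑β = ⊑-∷⁺ a (γ ++ β) (⊑-++⁺ˡ γ β x⊑β)

⊑-++⁺ʳ : ∀ {x} β δ → ⊢ᴮ x ⊑ biteral β → ⊢ᴮ x ⊑ biteral (β ++ δ)
⊑-++⁺ʳ {x} β []      x⊑β = subst (λ β′ → ⊢ᴮ x ⊑ biteral β′) (sym (++-identityʳ β)) x⊑β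
⊑-++⁺ʳ {x} β (b ∷ δ) x⊑β =
  subst (λ β′ → ⊢ᴮ x ⊑ biteral β′) (++-assoc β (b ∷ []) δ) (⊑-++⁺ʳ (β ∷ʳ b) δ (⊑-∷ʳ⁺ β b x⊑β))

lemma5 : (α β : BitString) → IsSubstring α β → B⊢ (biteral α ⊑ biteral β)
lemma5 α _ (γ , δ , refl) = ⊢ᴮ⇒B⊢ (⊑-++⁺ˡ γ (α ++ δ) (⊑-++⁺ʳ α δ (⊑-refl α)))
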